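{- $\rho_T(C_4)=2$, where $C_4$ is the cycle on four vertices.
   Context: Graphs are finite and simple. For $u,v\in(\mathbb{R}\cup\{\infty\})^k$, $u\odot v=\min_i(u_i+v_i)$. $\rho_T(G)$ is the minimum $k$ such that there is $f:V(G)\to(\mathbb{R}\cup\{\infty\})^k$ and a threshold $t>0$ with, for all distinct $x,y$, $xy\in E(G)$ iff $f(x)\odot f(y)\ge t$. -}

module Defs where

open import Level using (Level; suc; _⊔_)
open import Data.Nat using (ℕ; zero) renaming (_≤_ to _≤ℕ_)
open import Data.Nat using () renaming (suc to sucℕ)
open import Data.Fin using (Fin) renaming (zero to f0; suc to fs)
open import Data.Product using (Σ; _×_; _,_; ∃)
open import Data.Sum using (_⊎_; inj₁; inj₂)
open import Relation.Binary.PropositionalEquality using (_≡_)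
open import Relation.Binary.Structures using (IsTotalOrder)
open import Relation.Nullary using (¬_)
open import Data.Unit.Polymorphic using (⊤)
open import Function.Bundles using (_⇔_)

-- The definition of
-- ρ_T only uses the additive group (ℝ,+,0) together with its total order,
-- so we work over an arbitrary totally ordered abelian group R
-- (ℝ being one instance); the theorem is stated for every such R that has
-- a positive element (needed for the threshold t > 0).
record OrderedAbelianGroup (a ℓ : Level) : Set (suc (a ⊔ ℓ)) where
  infixl 6 _+_
  infix 4 _≤_
  field
    Carrier      : Set a
    _+_          : Carrier → Carrier → Carrier
    0#           : Carrier
    -_           : Carrier → Carrier
    _≤_          : Carrier → Carrier → Set ℓ
    isTotalOrder : IsTotalOrder _≡_ _≤_
    +-assoc      : ∀ x y z → (x + y) + z ≡ x + (y + z)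
    +-comm       : ∀ x y → x + y ≡ y + x
    +-identityˡ  : ∀ x → 0# + x ≡ x
    -‿inverseˡ   : ∀ x → (- x) + x ≡ 0#
    +-monoˡ-≤    : ∀ {x y} z → x ≤ y → x + z ≤ y + z

  _<_ : Carrier → Carrier → Set (a ⊔ ℓ)
  x < y = x ≤ y × ¬ (x ≡ y)

  open IsTotalOrder isTotalOrder public using (total)

module Extended {a ℓ : Level} (R : OrderedAbelianGroup a ℓ) where
  open OrderedAbelianGroup R

  data R∞ : Set a where
    fin : Carrier → R∞
    ∞   : R∞

  _+∞_ : R∞ → R∞ → R∞
  fin x +∞ fin y = fin (x + y)
  fin _ +∞ ∞     = ∞
  ∞     +∞ _     = ∞

  min∞ : R∞ → R∞ → R∞
  min∞ ∞       y       = y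
  min∞ (fin x) ∞       = fin x
  min∞ (fin x) (fin y) with total x y
  ... | inj₁ _ = fin x
  ... | inj₂ _ = fin y

  _≤ᵗ_ : Carrier → R∞ → Set ℓ
  t ≤ᵗ fin u = t ≤ u
  t ≤ᵗ ∞     = ⊤

  _⊙_ : {k : ℕ} → (Fin k → R∞) → (Fin k → R∞) → R∞
  _⊙_ {zero}   u v = ∞
  _⊙_ {sucℕ k} u v = min∞ (u f0 +∞ v f0) ((λ i → u (fs i)) ⊙ (λ i → v (fs i)))

  Representable : {n : ℕ} → (Fin n → Fin n → Set) → ℕ → Set (a ⊔ ℓ)
  Representable {n} Adj k =
    Σ (Fin n → Fin k → R∞) λ f → Σ Carrier λ t →
      (0# < t) × (∀ x y → ¬ (x ≡ y) → (Adj x y ⇔ (t ≤ᵗ (f x ⊙ f y))))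

  ρT≡ : {n : ℕ} → (Fin n → Fin n → Set) → ℕ → Set (a ⊔ ℓ)
  ρT≡ Adj m = Representable Adj m × (∀ k → Representable Adj k → m ≤ℕ k)

data C4Adj : Fin 4 → Fin 4 → Set where
  e01 : C4Adj f0 (fs f0)
  e10 : C4Adj (fs f0) f0
  e12 : C4Adj (fs f0) (fs (fs f0))
  e21 : C4Adj (fs (fs f0)) (fs f0)
  e23 : C4Adj (fs (fs f0)) (fs (fs (fs f0)))
  e32 : C4Adj (fs (fs (fs f0))) (fs (fs f0))
  e30 : C4Adj (fs (fs (fs f0))) f0
  e03 : C4Adj f0 (fs (fs (fs f0)))

-- If t ≤ a + b and t ≤ c + d then (a + c) + (b + d) = (a + b) + (c + d) ≥ 2t, so
-- t ≤ a + c or t ≤ b + d: whenever xy and zw are edges, so is xz or yw.  The edges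
-- 01 and 23 of C₄ would thus force one of the diagonals 02, 13, hence ρ_T(C₄) ≥ 2
-- (dimension 0 forces a complete graph).  Conversely C₄ = K₂,₂, and sending one side
-- to (0, ∞) and the other to (∞, 0) gives u ⊙ v = ∞ across the sides and u ⊙ v = 0
-- within a side.
module Submission where

open import Defs
open import Level using (Level)
open import Data.Product using (∃; _,_; proj₁; proj₂)
open import Data.Sum as Sum using (_⊎_; inj₁; inj₂)
open import Data.Empty using (⊥-elim)
open import Data.Nat using (ℕ; zero; suc; z≤n; s≤s) renaming (_≤_ to _≤ℕ_)
open import Data.Fin using (Fin; zero; suc)
open import Data.Unit.Polymorphic using (tt)
open import Function using (_∘_; id; case_of_)
open import Function.Bundles using (_⇔_; mk⇔; Equivalence)
open import Function.Construct.Composition using (_⇔-∘_)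
open import Function.Construct.Symmetry using (⇔-sym)
open import Relation.Binary.Bundles using (Poset)
open import Relation.Binary.PropositionalEquality
  using (_≡_; _≢_; refl; sym; cong; subst; subst₂; module ≡-Reasoning)
open import Relation.Binary.Structures using (IsTotalOrder)
open import Relation.Nullary using (¬_)

module OrderedAbelianGroupProperties {a ℓ : Level} (R : OrderedAbelianGroup a ℓ) where
  open OrderedAbelianGroup R
  open Extended R

  poset : Poset a a ℓ
  poset = record { isPartialOrder = IsTotalOrder.isPartialOrder isTotalOrder }


  +-identityʳ : ∀ x → x + 0# ≡ x
  +-identityʳ x = subst (_≡ x) (+-comm 0# x) (+-identityˡ x)

  x+y-y≡x : ∀ x y → (x + y) + (- y) ≡ x
  x+y-y≡x x y = begin
    (x + y) + (- y)  ≡⟨ +-assoc x y (- y) ⟩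
    x + (y + (- y))  ≡⟨ cong (x +_) (+-comm y (- y)) ⟩
    x + ((- y) + y)  ≡⟨ cong (x +_) (-‿inverseˡ y) ⟩
    x + 0#           ≡⟨ +-identityʳ x ⟩
    x                ∎
    where open ≡-Reasoning

  +-interchange : ∀ w x y z → (w + x) + (y + z) ≡ (w + y) + (x + z)
  +-interchange w x y z = begin
    (w + x) + (y + z)  ≡⟨ +-assoc w x (y + z) ⟩
    w + (x + (y + z))  ≡⟨ cong (w +_) (sym (+-assoc x y z)) ⟩
    w + ((x + y) + z)  ≡⟨ cong (λ v → w + (v + z)) (+-comm x y) ⟩
    w + ((y + x) + z)  ≡⟨ cong (w +_) (+-assoc y x z) ⟩
    w + (y + (x + z))  ≡⟨ sym (+-assoc w y (x + z)) ⟩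
    (w + y) + (x + z)  ∎
    where open ≡-Reasoning

  +-monoʳ-≤ : ∀ {x y} z → x ≤ y → z + x ≤ z + y
  +-monoʳ-≤ {x} {y} z x≤y = subst₂ _≤_ (+-comm x z) (+-comm y z) (+-monoˡ-≤ z x≤y)

  +-mono-≤ : ∀ {w x y z} → w ≤ x → y ≤ z → w + y ≤ x + z
  +-mono-≤ {w} {x} {y} {z} w≤x y≤z = begin
    w + y  ≤⟨ +-monoˡ-≤ y w≤x ⟩
    x + y  ≤⟨ +-monoʳ-≤ x y≤z ⟩
    x + z  ∎
    where open import Relation.Binary.Reasoning.PartialOrder poset

  +-cancelˡ-≤ : ∀ {x y} z → z + x ≤ z + y → x ≤ y
  +-cancelˡ-≤ {x} {y} z z+x≤z+y =
    subst₂ _≤_ (x+y-y≡x x z) (x+y-y≡x y z)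
      (+-monoˡ-≤ (- z) (subst₂ _≤_ (+-comm z x) (+-comm z y) z+x≤z+y))

  ≤-exchange : ∀ {t w x y z} → t ≤ w + x → t ≤ y + z → t ≤ w + y ⊎ t ≤ x + z
  ≤-exchange {t} {w} {x} {y} {z} t≤w+x t≤y+z with total t (w + y)
  ... | inj₁ t≤w+y = inj₁ t≤w+y
  ... | inj₂ w+y≤t = inj₂ (+-cancelˡ-≤ t (begin
    t + t              ≤⟨ +-mono-≤ t≤w+x t≤y+z ⟩
    (w + x) + (y + z)  ≡⟨ +-interchange w x y z ⟩
    (w + y) + (x + z)  ≤⟨ +-monoˡ-≤ (x + z) w+y≤t ⟩
    t + (x + z)        ∎))
    where open import Relation.Binary.Reasoning.PartialOrder poset

  ≤ᵗ-exchange : ∀ t (w x y z : R∞) →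
    t ≤ᵗ (w +∞ x) → t ≤ᵗ (y +∞ z) → t ≤ᵗ (w +∞ y) ⊎ t ≤ᵗ (x +∞ z)
  ≤ᵗ-exchange t ∞       x       y       z       _ _ = inj₁ tt
  ≤ᵗ-exchange t (fin _) x       ∞       z       _ _ = inj₁ tt
  ≤ᵗ-exchange t (fin _) ∞       (fin _) z       _ _ = inj₂ tt
  ≤ᵗ-exchange t (fin _) (fin _) (fin _) ∞       _ _ = inj₂ tt
  ≤ᵗ-exchange t (fin _) (fin _) (fin _) (fin _) p q = ≤-exchange p q

  ≤ᵗ-min∞-∞ : ∀ t z → t ≤ᵗ min∞ z ∞ ⇔ t ≤ᵗ z
  ≤ᵗ-min∞-∞ t (fin _) = mk⇔ id id
  ≤ᵗ-min∞-∞ t ∞       = mk⇔ id id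

module Representations {a ℓ : Level} (R : OrderedAbelianGroup a ℓ) where
  open OrderedAbelianGroup R
  open Extended R
  open OrderedAbelianGroupProperties R
  open Equivalence using (to; from)
  open Poset poset using (antisym)

  module _ {n : ℕ} {Adj : Fin n → Fin n → Set} where

    representable₀⇒complete : Representable Adj 0 → ∀ x y → x ≢ y → Adj x y
    representable₀⇒complete (_ , _ , _ , rep) x y x≢y = from (rep x y x≢y) tt

    representable₁⇒exchange : Representable Adj 1 →
      ∀ {x y z w} → x ≢ y → z ≢ w → x ≢ z → y ≢ w →
      Adj x y → Adj z w → Adj x z ⊎ Adj y w
    representable₁⇒exchange (f , t , _ , rep) {x} {y} {z} {w} x≢y z≢w x≢z y≢w xy zw =
      Sum.map (from (rep₁ x≢z)) (from (rep₁ y≢w))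
        (≤ᵗ-exchange t (f x zero) (f y zero) (f z zero) (f w zero)
          (to (rep₁ x≢y) xy) (to (rep₁ z≢w) zw))
      where
      rep₁ : ∀ {u v} → u ≢ v → Adj u v ⇔ t ≤ᵗ (f u zero +∞ f v zero)
      rep₁ {u} {v} u≢v = ≤ᵗ-min∞-∞ t (f u zero +∞ f v zero) ⇔-∘ rep u v u≢v

  module _ {t : Carrier} (0<t : 0# < t) where

    t≰0+0 : ¬ (t ≤ 0# + 0#)
    t≰0+0 t≤0+0 = proj₂ 0<t (antisym (proj₁ 0<t) (subst (t ≤_) (+-identityˡ 0#) t≤0+0))

    -- The vertices of side i are sent to the i-th unit vector of the tropical semiring.
    pole : Fin 2 → Fin 2 → R∞
    pole zero    zero    = fin 0#
    pole zero    (suc _) = ∞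
    pole (suc _) zero    = ∞
    pole (suc _) (suc _) = fin 0#

    ≤ᵗ-pole⊙pole : ∀ i j → t ≤ᵗ (pole i ⊙ pole j) ⇔ i ≢ j
    ≤ᵗ-pole⊙pole zero       zero       = mk⇔ (⊥-elim ∘ t≰0+0) (λ i≢i → ⊥-elim (i≢i refl))
    ≤ᵗ-pole⊙pole zero       (suc _)    = mk⇔ (λ _ ()) (λ _ → tt)
    ≤ᵗ-pole⊙pole (suc _)    zero       = mk⇔ (λ _ ()) (λ _ → tt)
    ≤ᵗ-pole⊙pole (suc zero) (suc zero) = mk⇔ (⊥-elim ∘ t≰0+0) (λ i≢i → ⊥-elim (i≢i refl))

    completeBipartite⇒representable₂ : ∀ {n} {Adj : Fin n → Fin n → Set} (side : Fin n → Fin 2) →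
      (∀ x y → x ≢ y → Adj x y ⇔ side x ≢ side y) → Representable Adj 2
    completeBipartite⇒representable₂ side bipartite =
      pole ∘ side , t , 0<t ,
      λ x y x≢y → ⇔-sym (≤ᵗ-pole⊙pole (side x) (side y)) ⇔-∘ bipartite x y x≢y

parity : Fin 4 → Fin 2
parity zero                   = zero
parity (suc zero)             = suc zero
parity (suc (suc zero))       = zero
parity (suc (suc (suc zero))) = suc zero

C4Adj⇔parity≢ : ∀ x y → C4Adj x y ⇔ parity x ≢ parity y
C4Adj⇔parity≢ x y = mk⇔ C4Adj⇒parity≢ (parity≢⇒C4Adj x y)
  where
  C4Adj⇒parity≢ : ∀ {x y} → C4Adj x y → parity x ≢ parity y
  C4Adj⇒parity≢ e01 ()
  C4Adj⇒parity≢ e10 ()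
  C4Adj⇒parity≢ e12 ()
  C4Adj⇒parity≢ e21 ()
  C4Adj⇒parity≢ e23 ()
  C4Adj⇒parity≢ e32 ()
  C4Adj⇒parity≢ e30 ()
  C4Adj⇒parity≢ e03 ()

  parity≢⇒C4Adj : ∀ x y → parity x ≢ parity y → C4Adj x y
  parity≢⇒C4Adj zero                   (suc zero)             _ = e01
  parity≢⇒C4Adj zero                   (suc (suc (suc zero))) _ = e03
  parity≢⇒C4Adj (suc zero)             zero                   _ = e10
  parity≢⇒C4Adj (suc zero)             (suc (suc zero))       _ = e12
  parity≢⇒C4Adj (suc (suc zero))       (suc zero)             _ = e21
  parity≢⇒C4Adj (suc (suc zero))       (suc (suc (suc zero))) _ = e23
  parity≢⇒C4Adj (suc (suc (suc zero))) zero                   _ = e30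
  parity≢⇒C4Adj (suc (suc (suc zero))) (suc (suc zero))       _ = e32
  parity≢⇒C4Adj zero                   zero                   p≢p = ⊥-elim (p≢p refl)
  parity≢⇒C4Adj zero                   (suc (suc zero))       p≢p = ⊥-elim (p≢p refl)
  parity≢⇒C4Adj (suc zero)             (suc zero)             p≢p = ⊥-elim (p≢p refl)
  parity≢⇒C4Adj (suc zero)             (suc (suc (suc zero))) p≢p = ⊥-elim (p≢p refl)
  parity≢⇒C4Adj (suc (suc zero))       zero                   p≢p = ⊥-elim (p≢p refl)
  parity≢⇒C4Adj (suc (suc zero))       (suc (suc zero))       p≢p = ⊥-elim (p≢p refl)
  parity≢⇒C4Adj (suc (suc (suc zero))) (suc zero)             p≢p = ⊥-elim (p≢p refl)
  parity≢⇒C4Adj (suc (suc (suc zero))) (suc (suc (suc zero))) p≢p = ⊥-elim (p≢p refl)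

mainTheorem11 : {a ℓ : Level} (R : OrderedAbelianGroup a ℓ) →
    ∃ (λ p → OrderedAbelianGroup._<_ R (OrderedAbelianGroup.0# R) p) →
    Extended.ρT≡ R C4Adj 2
mainTheorem11 R (t , 0<t) =
  completeBipartite⇒representable₂ 0<t parity (λ x y _ → C4Adj⇔parity≢ x y) , 2≤dim
  where
  open Extended R using (Representable)
  open Representations R

  2≤dim : ∀ k → Representable C4Adj k → 2 ≤ℕ k
  2≤dim zero ρ =
    case representable₀⇒complete ρ zero (suc (suc zero)) (λ ()) of λ ()
  2≤dim (suc zero) ρ =
    Sum.[ (λ ()) , (λ ()) ] (representable₁⇒exchange ρ (λ ()) (λ ()) (λ ()) (λ ()) e01 e23)
  2≤dim (suc (suc _)) _ = s≤s (s≤s z≤n)
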